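{- There exists a cyclic $(47;21,12;12)$ difference family, i.e. there exist subsets $X_1,X_2\subseteq \mathbb{Z}_{47}$ with $|X_1|=21$, $|X_2|=12$ such that for every nonzero $a\in\mathbb{Z}_{47}$, $$\#\{(x,y)\in X_1\times X_1: y-x=a\}+\#\{(x,y)\in X_2\times X_2: y-x=a\}=12.$$
   Context: $\mathbb{Z}_v$ denotes the cyclic group (ring) of integers modulo $v$. A cyclic $(v;r,s;\lambda)$ difference family is a pair $(X_1,X_2)$ of subsets of $\mathbb{Z}_v$ with $|X_1|=r$, $|X_2|=s$ such that for every nonzero $a\in\mathbb{Z}_v$ the total number of ordered pairs $(x,y)$ with $x,y$ in the same block $X_i$ and $y-x=a$ equals $\lambda$. -}

module Defs where

open import Data.Nat using (ℕ; _+_; _∸_; _%_)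
open import Data.Nat.DivMod using ()
open import Data.Fin using (Fin; toℕ)
open import Data.Fin.Subset using (Subset; _∈_)
open import Data.Fin.Subset.Properties using (_∈?_)
open import Data.List using (List; length; filter; cartesianProduct; allFin)
open import Data.Product using (_×_; _,_)
open import Relation.Nullary using (Dec; _×-dec_)
open import Relation.Binary.PropositionalEquality using (_≡_; _≢_)
open import Data.Nat.Properties using (_≟_)

-- Z_v is represented by Fin v; subtraction modulo v (v ≥ 1 implicit via suc).
subℤ : ∀ {n} → Fin (Data.Nat.suc n) → Fin (Data.Nat.suc n) → ℕ
subℤ {n} y x = (toℕ y + (Data.Nat.suc n ∸ toℕ x)) % Data.Nat.suc n

pairCount : ∀ {n} → Subset (Data.Nat.suc n) → Fin (Data.Nat.suc n) → ℕ
pairCount {n} X a =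
  length (filter (λ p → ((Data.Product.proj₁ p ∈? X) ×-dec (Data.Product.proj₂ p ∈? X))
                         ×-dec (subℤ (Data.Product.proj₂ p) (Data.Product.proj₁ p) ≟ toℕ a))
                 (cartesianProduct (allFin (Data.Nat.suc n)) (allFin (Data.Nat.suc n))))

-- cyclic (v; r, s; λ) difference family, v = suc n
IsCyclicDF : (n r s l : ℕ) → Subset (Data.Nat.suc n) → Subset (Data.Nat.suc n) → Set
IsCyclicDF n r s l X₁ X₂ =
  Data.Fin.Subset.∣ X₁ ∣ ≡ r × Data.Fin.Subset.∣ X₂ ∣ ≡ s ×
  (∀ (a : Fin (Data.Nat.suc n)) → toℕ a ≢ 0 → pairCount X₁ a + pairCount X₂ a ≡ l)

module Submission where

open import Defs
open import Data.Product using (∃₂; _,_)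
open import Data.Nat using (_+_)
open import Data.Nat.Properties using (_≟_)
open import Data.Fin using (Fin; toℕ; #_)
open import Data.Fin.Subset using (Subset; ⁅_⁆; ⋃)
open import Data.Fin.Properties using (all?)
open import Data.List using (List; map; _∷_; [])
open import Relation.Nullary using (¬?)
open import Relation.Nullary.Decidable using (toWitness; _→-dec_)
open import Relation.Binary.PropositionalEquality using (_≡_; _≢_; refl)

fromElements : ∀ {n} → List (Fin n) → Subset n
fromElements xs = ⋃ (map ⁅_⁆ xs)

X₁ : Subset 47
X₁ = fromElements (# 0 ∷ # 2 ∷ # 4 ∷ # 7 ∷ # 10 ∷ # 12 ∷ # 13 ∷ # 14 ∷ # 15 ∷ # 16 ∷ # 18 ∷
                   # 25 ∷ # 28 ∷ # 34 ∷ # 35 ∷ # 38 ∷ # 39 ∷ # 42 ∷ # 43 ∷ # 44 ∷ # 45 ∷ [])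

X₂ : Subset 47
X₂ = fromElements (# 0 ∷ # 6 ∷ # 7 ∷ # 10 ∷ # 11 ∷ # 19 ∷ # 24 ∷ # 30 ∷ # 32 ∷ # 39 ∷ # 41 ∷ # 46 ∷ [])

balancedDifferences : ∀ (a : Fin 47) → toℕ a ≢ 0 → pairCount X₁ a + pairCount X₂ a ≡ 12
balancedDifferences = toWitness {a? = all? λ a → ¬? (toℕ a ≟ 0) →-dec (pairCount X₁ a + pairCount X₂ a ≟ 12)} _

mainTheorem3 : ∃₂ λ X₁ X₂ → IsCyclicDF 46 21 12 12 X₁ X₂
mainTheorem3 = X₁ , X₂ , refl , refl , balancedDifferences
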